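{- For any $j\in\mathbb{N}$ and $r\in\mathbb{N}$ and all $n\in\mathbb{N}$, \[c_j^{(r-1)}(n)\le c_j^{(r)}(n);\] in particular $c_j(n)\le c_j^{(r)}(n)$. Moreover, \[c_j^{(r)}(n)\le d_{j+r}(n).\]
   Context: For $j\in\mathbb{N}$, $d_j(n)$ is the number of ordered tuples $(m_1,\dots,m_j)\in\mathbb{N}^j$ with $m_1\cdots m_j=n$, and $c_j(n)$ the number of such tuples with all $m_i\ge2$. The associated divisor functions are $c_j^{(0)}=c_j$ and $c_j^{(r)}(n)=\sum_{m\mid n}c_j^{(r-1)}(m)$ for $r,n\in\mathbb{N}$. -}

module Defs where

open import Data.Nat using (ℕ; zero; suc; _*_; _≤_; _≤?_; _≟_)
open import Data.Nat.Divisibility using (_∣_; _∣?_)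
open import Data.List using (List; []; _∷_; map; concatMap; filter; length; upTo)
open import Data.Nat.ListAction using (sum)
open import Data.Vec using (Vec; []; _∷_)
open import Data.Product using (_×_)
open import Relation.Binary.PropositionalEquality using (_≡_)
open import Relation.Nullary.Decidable using (_×-dec_)
import Data.Vec.Relation.Unary.All as VAll

range1 : ℕ → List ℕ
range1 n = map suc (upTo n)

tuples : (j n : ℕ) → List (Vec ℕ j)
tuples zero    n = [] ∷ []
tuples (suc j) n = concatMap (λ a → map (a ∷_) (tuples j n)) (range1 n)

vprod : ∀ {j} → Vec ℕ j → ℕ
vprod []       = 1
vprod (x ∷ xs) = x * vprod xs

-- d_j(n): number of ordered tuples (m_1,...,m_j) of positive integers with
-- m_1 ⋯ m_j = n.  For n ≥ 1 every such m_i lies in {1,...,n}, so enumerating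
-- tuples with entries in {1,...,n} counts them all.
d : ℕ → ℕ → ℕ
d j n = length (filter (λ v → vprod v ≟ n) (tuples j n))

c : ℕ → ℕ → ℕ
c j n = length (filter (λ v → VAll.all? (2 ≤?_) v ×-dec (vprod v ≟ n)) (tuples j n))

cr : ℕ → ℕ → ℕ → ℕ
cr j zero    n = c j n
cr j (suc r) n = sum (map (cr j r) (filter (_∣? n) (range1 n)))

{-# OPTIONS --safe #-}
-- Each tuple counted by c_j is counted by d_j, and c_j^(r)(n) contains the term m = n of its
-- divisor sum, which gives the two lower bounds.  The upper bound follows by induction on r from
-- Σ_{m ∣ n} d_k(m) ≤ d_{k+1}(n):  a k-tuple with product m ∣ n extends to the (k+1)-tuple
-- (n/m, m_1, …, m_k) with product n.  To compare the two enumerations both sides are written as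
-- double sums over k-tuples v and swapped; for fixed v the divisor m = ∏v occurs at most once on
-- the left, and then the cofactor a = n/∏v occurs on the right.
module Submission where

open import Defs
open import Data.Nat using (ℕ; zero; suc; _+_; _∸_; _*_; _≤_; _≥_; NonZero; _≤′_; ≤′-refl; ≤′-step; z≤n; s≤s; _≟_; >-nonZero; >-nonZero⁻¹)
open import Data.Nat.Properties
open import Algebra.Properties.CommutativeSemigroup +-commutativeSemigroup using (interchange)
open import Data.Nat.Divisibility using (_∣_; _∣?_; ∣-refl; ∣⇒≤; quotient-∣; quotient≢0)
open import Data.Nat.ListAction using (sum)
open import Data.List using (List; []; _∷_; [_]; _++_; map; concatMap; filter; length; upTo)
open import Data.List.Properties using (map-cong; length-++; filter-++; filter-none; upTo-∷ʳ)
open import Data.List.Membership.Propositional using (_∈_; _∉_)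
open import Data.List.Membership.Propositional.Properties using (∈-map⁺; ∈-map⁻; ∈-filter⁺; ∈-filter⁻; ∈-upTo⁺; ∈-upTo⁻)
open import Data.List.Membership.DecPropositional _≟_ using (_∈?_)
open import Data.List.Relation.Unary.Any using (here; there)
open import Data.List.Relation.Unary.All.Properties using (¬Any⇒All¬)
open import Data.List.Relation.Unary.AllPairs using ([]; _∷_)
open import Data.List.Relation.Unary.Unique.Propositional using (Unique)
import Data.List.Relation.Unary.Unique.Propositional.Properties as Unique
open import Data.List.Relation.Binary.Sublist.Propositional using (_⊆_; ⊆-refl)
open import Data.List.Relation.Binary.Sublist.Propositional.Properties using (++⁺ʳ; map⁺; concat⁺; filter⁺; length-mono-≤)
import Data.List.Relation.Binary.Sublist.Heterogeneous as Sublist using (map)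
import Data.List.Relation.Binary.Sublist.Heterogeneous.Properties as Sublist using (map⁺)
open import Data.Product using (_×_; _,_; proj₁; proj₂)
open import Data.Vec using (Vec; _∷_)
open import Function using (_∘_)
open import Level using (Level)
open import Relation.Nullary using (Dec; yes; no)
open import Relation.Unary using (Pred; Decidable)
open import Relation.Binary using (REL; DecidableEquality)
open import Relation.Binary.PropositionalEquality using (_≡_; refl; sym; trans; cong; subst; module ≡-Reasoning)

private
  variable
    a p ℓ : Level
    A B : Set a

𝟙 : {P : Set p} → Dec P → ℕ
𝟙 (yes _) = 1
𝟙 (no _)  = 0

count : {P : Pred A p} → Decidable P → List A → ℕ
count P? xs = length (filter P? xs)

∈⇒≤sum : ∀ {m ms} → m ∈ ms → m ≤ sum ms
∈⇒≤sum (here refl)             = m≤m+n _ _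
∈⇒≤sum {ms = n ∷ _} (there m∈) = ≤-trans (∈⇒≤sum m∈) (m≤n+m _ n)

sum-map-mono : {f g : A → ℕ} (xs : List A) → (∀ {x} → x ∈ xs → f x ≤ g x) →
               sum (map f xs) ≤ sum (map g xs)
sum-map-mono []       f≤g = z≤n
sum-map-mono (x ∷ xs) f≤g = +-mono-≤ (f≤g (here refl)) (sum-map-mono xs (f≤g ∘ there))

sum-map-0 : (xs : List A) → sum (map (λ _ → 0) xs) ≡ 0
sum-map-0 []       = refl
sum-map-0 (_ ∷ xs) = sum-map-0 xs

sum-map-+ : (f g : A → ℕ) (xs : List A) →
            sum (map (λ x → f x + g x) xs) ≡ sum (map f xs) + sum (map g xs)
sum-map-+ f g []       = refl
sum-map-+ f g (x ∷ xs) = trans (cong (f x + g x +_) (sum-map-+ f g xs)) (interchange (f x) (g x) _ _)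

sum-map-swap : (f : A → B → ℕ) (xs : List A) (ys : List B) →
               sum (map (λ x → sum (map (f x) ys)) xs) ≡ sum (map (λ y → sum (map (λ x → f x y) xs)) ys)
sum-map-swap f []       ys = sym (sum-map-0 ys)
sum-map-swap f (x ∷ xs) ys =
  trans (cong (sum (map (f x) ys) +_) (sum-map-swap f xs ys)) (sym (sum-map-+ (f x) _ ys))

count≡sum-𝟙 : {P : Pred A p} (P? : Decidable P) (xs : List A) → count P? xs ≡ sum (map (𝟙 ∘ P?) xs)
count≡sum-𝟙 P? []       = refl
count≡sum-𝟙 P? (x ∷ xs) with P? x
... | yes _ = cong suc (count≡sum-𝟙 P? xs)
... | no  _ = count≡sum-𝟙 P? xs

sum-count-swap : {R : REL A B ℓ} (R? : ∀ x y → Dec (R x y)) (xs : List A) (ys : List B) →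
                 sum (map (λ x → count (R? x) ys) xs) ≡ sum (map (λ y → count (λ x → R? x y) xs) ys)
sum-count-swap R? xs ys = begin
  sum (map (λ x → count (R? x) ys) xs)
    ≡⟨ cong sum (map-cong (λ x → count≡sum-𝟙 (R? x) ys) xs) ⟩
  sum (map (λ x → sum (map (𝟙 ∘ R? x) ys)) xs)
    ≡⟨ sum-map-swap (λ x y → 𝟙 (R? x y)) xs ys ⟩
  sum (map (λ y → sum (map (λ x → 𝟙 (R? x y)) xs)) ys)
    ≡⟨ cong sum (map-cong (λ y → count≡sum-𝟙 (λ x → R? x y) xs) ys) ⟨
  sum (map (λ y → count (λ x → R? x y) xs) ys) ∎
  where open ≡-Reasoning

count-map : {P : Pred B p} (P? : Decidable P) (f : A → B) (xs : List A) →
            count P? (map f xs) ≡ count (P? ∘ f) xs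
count-map P? f []       = refl
count-map P? f (x ∷ xs) with P? (f x)
... | yes _ = cong suc (count-map P? f xs)
... | no  _ = count-map P? f xs

count-concatMap : {P : Pred B p} (P? : Decidable P) (f : A → List B) (xs : List A) →
                  count P? (concatMap f xs) ≡ sum (map (count P? ∘ f) xs)
count-concatMap P? f []       = refl
count-concatMap P? f (x ∷ xs) = begin
  length (filter P? (f x ++ concatMap f xs))
    ≡⟨ cong length (filter-++ P? (f x) (concatMap f xs)) ⟩
  length (filter P? (f x) ++ filter P? (concatMap f xs))
    ≡⟨ length-++ (filter P? (f x)) ⟩
  count P? (f x) + count P? (concatMap f xs)
    ≡⟨ cong (count P? (f x) +_) (count-concatMap P? f xs) ⟩
  count P? (f x) + sum (map (count P? ∘ f) xs) ∎
  where open ≡-Reasoning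

count-pos : {P : Pred A p} (P? : Decidable P) {x : A} {xs : List A} → x ∈ xs → P x → 1 ≤ count P? xs
count-pos P? x∈ px = ∈⇒1≤length (∈-filter⁺ P? x∈ px)
  where
  ∈⇒1≤length : ∀ {x ys} → x ∈ ys → 1 ≤ length ys
  ∈⇒1≤length {ys = _ ∷ _} _ = s≤s z≤n

module _ (_≟ᴬ_ : DecidableEquality A) where

  count-∉ : ∀ {x xs} → x ∉ xs → count (x ≟ᴬ_) xs ≡ 0
  count-∉ {xs = xs} x∉ = cong length (filter-none (_ ≟ᴬ_) (¬Any⇒All¬ xs x∉))

  count-unique≤1 : ∀ {xs} → Unique xs → ∀ x → count (x ≟ᴬ_) xs ≤ 1
  count-unique≤1 []          x = z≤n
  count-unique≤1 {y ∷ _} (y∉ ∷ u) x with x ≟ᴬ y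
  ... | yes refl = s≤s (≤-reflexive (cong length (filter-none (_ ≟ᴬ_) y∉)))
  ... | no  _    = count-unique≤1 u x

range1-⊆ : ∀ {m n} → m ≤ n → range1 m ⊆ range1 n
range1-⊆ m≤n = map⁺ suc (upTo-⊆ (≤⇒≤′ m≤n))
  where
  upTo-⊆ : ∀ {m n} → m ≤′ n → upTo m ⊆ upTo n
  upTo-⊆ ≤′-refl              = ⊆-refl
  upTo-⊆ {m} (≤′-step {n} p) = subst (upTo m ⊆_) (upTo-∷ʳ n) (++⁺ʳ [ n ] (upTo-⊆ p))

∈-range1⁺ : ∀ {m n} → 1 ≤ m → m ≤ n → m ∈ range1 n
∈-range1⁺ {suc _} _ m≤n = ∈-map⁺ suc (∈-upTo⁺ m≤n)

∈-range1⁻ : ∀ {m n} → m ∈ range1 n → 1 ≤ m × m ≤ n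
∈-range1⁻ m∈ with ∈-map⁻ suc m∈
... | _ , i∈ , refl = s≤s z≤n , ∈-upTo⁻ i∈

divisors : ℕ → List ℕ
divisors n = filter (_∣? n) (range1 n)

divisors-unique : ∀ n → Unique (divisors n)
divisors-unique n = Unique.filter⁺ (_∣? n) (Unique.map⁺ suc-injective (Unique.upTo⁺ n))

∈-divisors⁻ : ∀ n {m} → m ∈ divisors n → 1 ≤ m × m ≤ n
∈-divisors⁻ n = ∈-range1⁻ ∘ proj₁ ∘ ∈-filter⁻ (_∣? n) {xs = range1 n}

≤-sum-divisors : (f : ℕ → ℕ) → ∀ {n} → 1 ≤ n → f n ≤ sum (map f (divisors n))
≤-sum-divisors f 1≤n = ∈⇒≤sum (∈-map⁺ f (∈-filter⁺ (_∣? _) (∈-range1⁺ 1≤n ≤-refl) ∣-refl))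

quotient∈range1 : ∀ {m n} → 1 ≤ n → (m∣n : m ∣ n) → _∣_.quotient m∣n ∈ range1 n
quotient∈range1 {n = n} 1≤n m∣n =
  ∈-range1⁺ (>-nonZero⁻¹ _ ⦃ quotient≢0 m∣n ⦄) (∣⇒≤ (quotient-∣ m∣n))
  where instance
    n≢0 : NonZero n
    n≢0 = >-nonZero 1≤n

count-divisors≤count-cofactors : ∀ {n} → 1 ≤ n → ∀ p →
  count (p ≟_) (divisors n) ≤ count (λ a → a * p ≟ n) (range1 n)
count-divisors≤count-cofactors {n} 1≤n p with p ∈? divisors n
... | no  p∉ = ≤-trans (≤-reflexive (count-∉ _≟_ {xs = divisors n} p∉)) z≤n
... | yes p∈ = ≤-trans (count-unique≤1 _≟_ (divisors-unique n) p)
                       (count-pos (λ a → a * p ≟ n) (quotient∈range1 1≤n p∣n) (sym (_∣_.equality p∣n)))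
  where
  p∣n : p ∣ n
  p∣n = proj₂ (∈-filter⁻ (_∣? n) {xs = range1 n} p∈)

tuples-⊆ : ∀ k {m n} → m ≤ n → tuples k m ⊆ tuples k n
tuples-⊆ zero    m≤n = ⊆-refl
tuples-⊆ (suc k) {m} {n} m≤n =
  concat⁺ (Sublist.map⁺ _ _ (Sublist.map prepend (range1-⊆ m≤n)))
  where
  prepend : ∀ {a b} → a ≡ b → map (a ∷_) (tuples k m) ⊆ map (b ∷_) (tuples k n)
  prepend refl = map⁺ _ (tuples-⊆ k m≤n)

c≤d : ∀ j n → c j n ≤ d j n
c≤d j n = length-mono-≤ (filter⁺ _ (λ v → vprod v ≟ n) {as = tuples j n} (λ { refl → proj₂ }) ⊆-refl)

d≤count : ∀ k {m n} → m ≤ n → d k m ≤ count (λ v → vprod v ≟ m) (tuples k n)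
d≤count k m≤n = length-mono-≤ (filter⁺ _ _ (λ { refl p → p }) (tuples-⊆ k m≤n))

d-suc : ∀ k n → d (suc k) n ≡ sum (map (λ a → count (λ v → a * vprod v ≟ n) (tuples k n)) (range1 n))
d-suc k n = trans (count-concatMap (λ v → vprod v ≟ n) _ (range1 n))
                  (cong sum (map-cong (λ a → count-map (λ v → vprod v ≟ n) (a ∷_) (tuples k n)) (range1 n)))

sum-d-divisors≤d-suc : ∀ k {n} → 1 ≤ n → sum (map (d k) (divisors n)) ≤ d (suc k) n
sum-d-divisors≤d-suc k {n} 1≤n = begin
  sum (map (d k) (divisors n))
    ≤⟨ sum-map-mono (divisors n) (d≤count k ∘ proj₂ ∘ ∈-divisors⁻ n) ⟩
  sum (map (λ m → count (λ v → vprod v ≟ m) T) (divisors n))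
    ≡⟨ sum-count-swap (λ m v → vprod v ≟ m) (divisors n) T ⟩
  sum (map (λ v → count (vprod v ≟_) (divisors n)) T)
    ≤⟨ sum-map-mono T (λ {v} _ → count-divisors≤count-cofactors 1≤n (vprod v)) ⟩
  sum (map (λ v → count (λ a → a * vprod v ≟ n) (range1 n)) T)
    ≡⟨ sum-count-swap (λ a v → a * vprod v ≟ n) (range1 n) T ⟨
  sum (map (λ a → count (λ v → a * vprod v ≟ n) T) (range1 n))
    ≡⟨ d-suc k n ⟨
  d (suc k) n ∎
  where
  open ≤-Reasoning
  T : List (Vec ℕ k)
  T = tuples k n

c≤cr : ∀ j r {n} → 1 ≤ n → c j n ≤ cr j r n
c≤cr j zero    1≤n = ≤-refl
c≤cr j (suc r) 1≤n = ≤-trans (c≤cr j r 1≤n) (≤-sum-divisors (cr j r) 1≤n)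

cr≤d : ∀ j r {n} → 1 ≤ n → cr j r n ≤ d (j + r) n
cr≤d j zero    {n} 1≤n = subst (λ k → c j n ≤ d k n) (sym (+-identityʳ j)) (c≤d j n)
cr≤d j (suc r) {n} 1≤n = subst (λ k → cr j (suc r) n ≤ d k n) (sym (+-suc j r)) (begin
  sum (map (cr j r) (divisors n))      ≤⟨ sum-map-mono (divisors n) (cr≤d j r ∘ proj₁ ∘ ∈-divisors⁻ n) ⟩
  sum (map (d (j + r)) (divisors n))   ≤⟨ sum-d-divisors≤d-suc (j + r) 1≤n ⟩
  d (suc (j + r)) n                    ∎)
  where open ≤-Reasoning

lemma21 : ∀ (j r n : ℕ) → j ≥ 1 → r ≥ 1 → n ≥ 1 →
    (cr j (r ∸ 1) n ≤ cr j r n) × (c j n ≤ cr j r n) × (cr j r n ≤ d (j + r) n)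
lemma21 j r@(suc r′) n _ _ 1≤n = ≤-sum-divisors (cr j r′) 1≤n , c≤cr j r 1≤n , cr≤d j r 1≤n
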